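{- Let $T$ be a finite rooted ordered tree consisting of a root $r$ whose children, from left to right, are the roots of the subtrees $A_1,A_2,\ldots,A_n$, $n\ge1$. If $n=1$, then $T^*=(r\rightarrow A_1)^*$. If $n\ge2$, then $$T^*=(r\rightarrow A_1)^*\curvearrowright(r\rightarrow A_2)^*\curvearrowright\cdots\curvearrowright(r\rightarrow A_n)^*.$$
   Context: For a tree $A$ and a node $r$, $r\rightarrow A$ is the tree obtained by adding $r$ as a new root whose only child is the root of $A$. Tree joining: for rooted ordered trees $T_1,T_2$ with roots $r_1,r_2$ such that the rightmost child of $r_2$ exists and is a leaf, $T_1\curvearrowright T_2$ is the tree obtained from $T_2$ by inserting the children of $r_1$ (with their subtrees, in their order) as the children of the rightmost child of $r_2$; iterated joins are left-associated: $T_1\curvearrowright T_2\curvearrowright\cdots\curvearrowright T_n:=((T_1\curvearrowright T_2)\curvearrowright\cdots)\curvearrowright T_n$. All trees $(r\rightarrow A_i)^*$ share the root $r$, and the result is identified with a tree on the vertex set of $T$. Dual tree: for a tree $T$ with root $r$, $T^*$ has the same vertex set and root $r$; with $rmc_T(u)$ the rightmost child and $ils_T(u)$ the immediate left sibling of $u$ in $T$: (1a) $r$ has no parent in $T^*$; (1b) if $v=rmc_T(r)$ then $v$ is the rightmost child of $r$ in $T^*$; (2) if $v=rmc_T(u)$ with $u\ne r$, then $v$ is the immediate left sibling of $u$ in $T^*$; (3) if $v=ils_T(u)$, then $v$ is the rightmost child of $u$ in $T^*$. (In $(r\rightarrow A_i)^*$ the rightmost child of $r$ is the root of $A_i$ and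 is a leaf, so the joins are defined.) -}

module Defs where

open import Data.List using (List; []; _∷_; _++_; [_]; foldl; concatMap)
open import Data.List.Relation.Unary.Any using (Any)
open import Data.List.Membership.Propositional using (_∈_)
open import Data.List.Relation.Unary.Unique.Propositional using (Unique)
open import Data.List.Relation.Binary.Permutation.Propositional using (_↭_)
open import Data.Product using (Σ; _×_; ∃; ∃-syntax)
open import Relation.Binary.PropositionalEquality using (_≡_; _≢_)
open import Relation.Nullary using (¬_)

-- Finite rooted ordered trees whose vertices are labelled by elements of V
-- (children are listed from left to right).
data Tree (V : Set) : Set where
  node : V → List (Tree V) → Tree V

module _ {V : Set} where

  root : Tree V → V
  root (node v _) = v

  roots : List (Tree V) → List V
  roots []       = []
  roots (t ∷ ts) = root t ∷ roots ts

  verts  : Tree V → List V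
  vertsF : List (Tree V) → List V
  verts (node v ts) = v ∷ vertsF ts
  vertsF []       = []
  vertsF (t ∷ ts) = verts t ++ vertsF ts

  data HasChildren : Tree V → V → List V → Set where
    here  : ∀ {v ts} → HasChildren (node v ts) v (roots ts)
    there : ∀ {v ts u cs} → Any (λ t → HasChildren t u cs) ts →
            HasChildren (node v ts) u cs

  RMC : Tree V → V → V → Set
  RMC T u v = ∃[ cs ] HasChildren T u (cs ++ [ v ])

  ILS : Tree V → V → V → Set
  ILS T u v = ∃[ p ] ∃[ cs ] ∃[ ds ] HasChildren T p (cs ++ v ∷ u ∷ ds)

  HasParent : Tree V → V → Set
  HasParent T u = ∃[ p ] ∃[ cs ] (HasChildren T p cs × u ∈ cs)

  record IsDual (T D : Tree V) : Set where
    field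
      sameRoot  : root D ≡ root T
      sameVerts : verts D ↭ verts T
      rule1a    : ¬ HasParent D (root T)
      rule1b    : ∀ v → RMC T (root T) v → RMC D (root T) v
      rule2     : ∀ u v → RMC T u v → u ≢ root T → ILS D u v
      rule3     : ∀ u v → ILS T u v → RMC D u v

  _⇒_ : V → Tree V → Tree V
  r ⇒ A = node r [ A ]

  -- Insert the trees ts1 as children of the rightmost tree of the list.
  -- (Only used when that rightmost tree is a leaf, where appending
  -- children is exactly "inserting the children".)
  graft : List (Tree V) → List (Tree V) → List (Tree V)
  graft ts1 []                      = []
  graft ts1 (node c cs ∷ [])        = node c (cs ++ ts1) ∷ []
  graft ts1 (t ∷ t' ∷ ts)           = t ∷ graft ts1 (t' ∷ ts)

  _↷_ : Tree V → Tree V → Tree V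
  node r1 ts1 ↷ node r2 ts2 = node r2 (graft ts1 ts2)

  joinAll : Tree V → List (Tree V) → Tree V
  joinAll T1 Ts = foldl _↷_ T1 Ts

-- A tree with distinct vertices has at most one dual: the rules can be inverted, so any two duals
-- have the same rightmost-child and immediate-left-sibling relations, and these relations determine
-- the child list of every vertex (read from right to left), hence the tree.
-- For existence, the dual of r → B has a root child list ending in the leaf root B. Grafting the
-- root's children of a dual J of node r As below that leaf gives a dual of node r (As ∷ʳ B): the
-- rules for the old subtrees are inherited from J and from (r → B)*, and the only new instances
-- sit at the junction, where the rightmost child of r in J becomes the rightmost child of root B,
-- exactly as rule (3) demands for the new sibling pair (last root of As, root B).

module Submission where

open import Defs
open import Data.Empty using (⊥-elim)
open import Data.List using (List; []; _∷_; _++_; [_]; _∷ʳ_; _∷ʳ′_; initLast)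
open import Data.List.Properties using (∷-injectiveˡ; ∷-injectiveʳ; ∷ʳ-injective; ∷ʳ-injectiveʳ; ∷ʳ-++; ++-assoc; ++-identityʳ)
open import Data.List.Reverse using (Reverse; []; _∶_∶ʳ_; reverseView)
open import Data.List.Relation.Unary.All using ([]; _∷_)
import Data.List.Relation.Unary.All as All
import Data.List.Relation.Unary.All.Properties as All
open import Data.List.Relation.Unary.AllPairs using ([]; _∷_)
open import Data.List.Relation.Unary.Any using (Any; here; there)
open import Data.List.Relation.Unary.Any.Properties using (++⁺ˡ; ++⁺ʳ; ++⁻)
open import Data.List.Relation.Unary.Unique.Propositional using (Unique)
open import Data.List.Relation.Unary.Unique.Propositional.Properties using (Unique[x∷xs]⇒x∉xs)
open import Data.List.Membership.Propositional using (_∈_; _∉_)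
open import Data.List.Membership.Propositional.Properties using (∈-++⁺ˡ; ∈-++⁺ʳ; ∈-++⁻; ∈-∃++)
open import Data.List.Relation.Binary.Permutation.Propositional using (_↭_; ↭-sym; prep; swap; module PermutationReasoning)
import Data.List.Relation.Binary.Permutation.Propositional as ↭
open import Data.List.Relation.Binary.Permutation.Propositional.Properties using (All-resp-↭; ∈-resp-↭; drop-∷; ++-comm)
import Data.List.Relation.Binary.Permutation.Propositional.Properties as ↭
open import Data.List.Relation.Binary.Pointwise using (Pointwise; []; _∷_)
open import Data.Product using (_×_; _,_; proj₁; proj₂; ∃-syntax; uncurry)
open import Data.Sum using (_⊎_; inj₁; inj₂)
open import Function using (_∘_)
open import Function.Bundles using (_⇔_; mk⇔; Equivalence)
open import Relation.Binary.PropositionalEquality using (_≡_; _≢_; refl; sym; trans; cong; cong₂; subst)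
open import Relation.Nullary using (¬_)

module _ {A : Set} where

  ++-∷≢[] : ∀ (xs : List A) {x ys} → xs ++ x ∷ ys ≢ []
  ++-∷≢[] []      ()
  ++-∷≢[] (_ ∷ _) ()

  Unique-resp-↭ : {xs ys : List A} → xs ↭ ys → Unique xs → Unique ys
  Unique-resp-↭ ↭.refl        u        = u
  Unique-resp-↭ (prep x p)    (x∉ ∷ u) = All-resp-↭ p x∉ ∷ Unique-resp-↭ p u
  Unique-resp-↭ (swap x y p)  ((x≢y ∷ x∉) ∷ y∉ ∷ u) =
    ((x≢y ∘ sym) ∷ All-resp-↭ p y∉) ∷ All-resp-↭ p x∉ ∷ Unique-resp-↭ p u
  Unique-resp-↭ (↭.trans p q) u        = Unique-resp-↭ q (Unique-resp-↭ p u)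

  Unique-++⁻ˡ : ∀ (xs : List A) {ys} → Unique (xs ++ ys) → Unique xs
  Unique-++⁻ˡ []       _        = []
  Unique-++⁻ˡ (x ∷ xs) (x∉ ∷ u) = All.++⁻ˡ xs x∉ ∷ Unique-++⁻ˡ xs u

  Unique-++⁻ʳ : ∀ (xs : List A) {ys} → Unique (xs ++ ys) → Unique ys
  Unique-++⁻ʳ []       u       = u
  Unique-++⁻ʳ (x ∷ xs) (_ ∷ u) = Unique-++⁻ʳ xs u

  Unique-∷-++⁻ʳ : ∀ {x : A} xs {ys} → Unique (x ∷ xs ++ ys) → Unique (x ∷ ys)
  Unique-∷-++⁻ʳ xs (x∉ ∷ u) = All.++⁻ʳ xs x∉ ∷ Unique-++⁻ʳ xs u

  Unique-++⇒disjoint : ∀ (xs : List A) {ys x} → Unique (xs ++ ys) → x ∈ xs → x ∉ ys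
  Unique-++⇒disjoint (_ ∷ xs) (x∉ ∷ _) (here refl) m = All.lookup x∉ (∈-++⁺ʳ xs m) refl
  Unique-++⇒disjoint (_ ∷ xs) (_ ∷ u)  (there i)      = Unique-++⇒disjoint xs u i

  Unique-++-∷-injective : ∀ (xs xs' : List A) {v ys ys'} → Unique (xs ++ v ∷ ys) →
                          xs ++ v ∷ ys ≡ xs' ++ v ∷ ys' → xs ≡ xs' × ys ≡ ys'
  Unique-++-∷-injective []       []         _ refl = refl , refl
  Unique-++-∷-injective []       (_ ∷ xs')  u refl = ⊥-elim (Unique[x∷xs]⇒x∉xs u (∈-++⁺ʳ xs' (here refl)))
  Unique-++-∷-injective (_ ∷ xs) []         u refl = ⊥-elim (Unique[x∷xs]⇒x∉xs u (∈-++⁺ʳ xs (here refl)))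
  Unique-++-∷-injective (x ∷ xs) (_ ∷ xs') (_ ∷ u) eq with refl ← ∷-injectiveˡ eq
    with xs≡xs' , ys≡ys' ← Unique-++-∷-injective xs xs' u (∷-injectiveʳ eq)
    = cong (x ∷_) xs≡xs' , ys≡ys'

module _ {V : Set} where

  private variable
    t T D D' : Tree V
    ts : List (Tree V)
    p q u v w x : V
    cs cs' : List V

  HasChildrenF : List (Tree V) → V → List V → Set
  HasChildrenF ts p cs = Any (λ t → HasChildren t p cs) ts

  roots-++ : (ts us : List (Tree V)) → roots (ts ++ us) ≡ roots ts ++ roots us
  roots-++ []       us = refl
  roots-++ (t ∷ ts) us = cong (root t ∷_) (roots-++ ts us)

  vertsF-++ : (ts us : List (Tree V)) → vertsF (ts ++ us) ≡ vertsF ts ++ vertsF us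
  vertsF-++ []       us = refl
  vertsF-++ (t ∷ ts) us = trans (cong (verts t ++_) (vertsF-++ ts us)) (sym (++-assoc (verts t) (vertsF ts) (vertsF us)))

  graft-leaf : (ts L : List (Tree V)) (c : V) → graft ts (L ∷ʳ node c []) ≡ L ∷ʳ node c ts
  graft-leaf ts []                  c = refl
  graft-leaf ts (node _ _ ∷ [])     c = refl
  graft-leaf ts (node w ws ∷ t ∷ L) c = cong (node w ws ∷_) (graft-leaf ts (t ∷ L) c)

  root∈verts : (t : Tree V) → root t ∈ verts t
  root∈verts (node _ _) = here refl

  roots⊆vertsF : x ∈ roots ts → x ∈ vertsF ts
  roots⊆vertsF {ts = t ∷ ts} (here refl) = ∈-++⁺ˡ (root∈verts t)
  roots⊆vertsF {ts = t ∷ ts} (there m)   = ∈-++⁺ʳ (verts t) (roots⊆vertsF m)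

  parent∈verts  : HasChildren t p cs → p ∈ verts t
  parent∈vertsF : HasChildrenF ts p cs → p ∈ vertsF ts
  parent∈verts here      = here refl
  parent∈verts (there h) = there (parent∈vertsF h)
  parent∈vertsF               (here h)  = ∈-++⁺ˡ (parent∈verts h)
  parent∈vertsF {ts = t ∷ _}  (there h) = ∈-++⁺ʳ (verts t) (parent∈vertsF h)

  child∈descendants : HasChildren (node w ts) p cs → x ∈ cs → x ∈ vertsF ts
  child∈vertsF      : HasChildrenF ts p cs → x ∈ cs → x ∈ vertsF ts
  child∈descendants here      m = roots⊆vertsF m
  child∈descendants (there h) m = child∈vertsF h m
  child∈vertsF {ts = node _ _ ∷ _} (here h)  m = ∈-++⁺ˡ (there (child∈descendants h m))
  child∈vertsF {ts = t ∷ _}        (there h) m = ∈-++⁺ʳ (verts t) (child∈vertsF h m)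

  child∈verts : HasChildren t p cs → x ∈ cs → x ∈ verts t
  child∈verts {t = node _ _} h m = there (child∈descendants h m)

  vertsF⇒root⊎child : ∀ ts → x ∈ vertsF ts → x ∈ roots ts ⊎ ∃[ p ] ∃[ cs ] (HasChildrenF ts p cs × x ∈ cs)
  vertsF⇒root⊎child (node w us ∷ ts) m with ∈-++⁻ (w ∷ vertsF us) m
  ... | inj₁ (here refl) = inj₁ (here refl)
  ... | inj₁ (there m') with vertsF⇒root⊎child us m'
  ...   | inj₁ r                = inj₂ (w , roots us , here here , r)
  ...   | inj₂ (p , cs , h , r) = inj₂ (p , cs , here (there h) , r)
  vertsF⇒root⊎child (_ ∷ ts) m | inj₂ m' with vertsF⇒root⊎child ts m'
  ...   | inj₁ r                = inj₁ (there r)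
  ...   | inj₂ (p , cs , h , r) = inj₂ (p , cs , there h , r)

  nonroot⇒HasParent : x ∈ verts t → x ≢ root t → HasParent t x
  nonroot⇒HasParent {t = node w ts} (here refl) x≢w = ⊥-elim (x≢w refl)
  nonroot⇒HasParent {t = node w ts} (there m)   _   with vertsF⇒root⊎child ts m
  ... | inj₁ r                = w , roots ts , here , r
  ... | inj₂ (p , cs , h , r) = p , cs , there h , r

  HasChildren-functional  : Unique (verts t) →
                            HasChildren t p cs → HasChildren t p cs' → cs ≡ cs'
  HasChildrenF-functional : Unique (vertsF ts) →
                            HasChildrenF ts p cs → HasChildrenF ts p cs' → cs ≡ cs'
  HasChildren-functional _        here      here       = refl
  HasChildren-functional (w∉ ∷ _) here      (there h') = ⊥-elim (All.lookup w∉ (parent∈vertsF h') refl)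
  HasChildren-functional (w∉ ∷ _) (there h) here       = ⊥-elim (All.lookup w∉ (parent∈vertsF h) refl)
  HasChildren-functional (_ ∷ u)  (there h) (there h') = HasChildrenF-functional u h h'
  HasChildrenF-functional {ts = t ∷ _} u (here h)  (here h')  = HasChildren-functional (Unique-++⁻ˡ (verts t) u) h h'
  HasChildrenF-functional {ts = t ∷ _} u (here h)  (there h') =
    ⊥-elim (Unique-++⇒disjoint (verts t) u (parent∈verts h) (parent∈vertsF h'))
  HasChildrenF-functional {ts = t ∷ _} u (there h) (here h')  =
    ⊥-elim (Unique-++⇒disjoint (verts t) u (parent∈verts h') (parent∈vertsF h))
  HasChildrenF-functional {ts = t ∷ _} u (there h) (there h') = HasChildrenF-functional (Unique-++⁻ʳ (verts t) u) h h'

  root-orphan : Unique (verts t) → ¬ HasParent t (root t)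
  root-orphan {t = node _ _} (w∉ ∷ _) (_ , _ , h , m) = All.lookup w∉ (child∈descendants h m) refl

  child≢root : Unique (verts t) → HasChildren t p cs → x ∈ cs → x ≢ root t
  child≢root u h m refl = root-orphan u (_ , _ , h , m)

  root-not-childF : Unique (vertsF ts) → x ∈ roots ts → HasChildrenF ts q cs → x ∉ cs
  root-not-childF {ts = t ∷ _} u (here refl) (here h)  m = root-orphan (Unique-++⁻ˡ (verts t) u) (_ , _ , h , m)
  root-not-childF {ts = t ∷ _} u (here refl) (there h) m = Unique-++⇒disjoint (verts t) u (root∈verts t) (child∈vertsF h m)
  root-not-childF {ts = t ∷ _} u (there r)   (here h)  m = Unique-++⇒disjoint (verts t) u (child∈verts h m) (roots⊆vertsF r)
  root-not-childF {ts = t ∷ _} u (there r)   (there h) m = root-not-childF (Unique-++⁻ʳ (verts t) u) r h m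

  parent-unique  : Unique (verts t) →
                   HasChildren t p cs → HasChildren t q cs' → x ∈ cs → x ∈ cs' → p ≡ q
  parentF-unique : Unique (vertsF ts) →
                   HasChildrenF ts p cs → HasChildrenF ts q cs' → x ∈ cs → x ∈ cs' → p ≡ q
  parent-unique _       here      here       _ _  = refl
  parent-unique (_ ∷ u) here      (there h') m m' = ⊥-elim (root-not-childF u m h' m')
  parent-unique (_ ∷ u) (there h) here       m m' = ⊥-elim (root-not-childF u m' h m)
  parent-unique (_ ∷ u) (there h) (there h') m m' = parentF-unique u h h' m m'
  parentF-unique {ts = t ∷ _} u (here h)  (here h')  m m' = parent-unique (Unique-++⁻ˡ (verts t) u) h h' m m'
  parentF-unique {ts = t ∷ _} u (here h)  (there h') m m' =
    ⊥-elim (Unique-++⇒disjoint (verts t) u (child∈verts h m) (child∈vertsF h' m'))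
  parentF-unique {ts = t ∷ _} u (there h) (here h')  m m' =
    ⊥-elim (Unique-++⇒disjoint (verts t) u (child∈verts h' m') (child∈vertsF h m))
  parentF-unique {ts = t ∷ _} u (there h) (there h') m m' = parentF-unique (Unique-++⁻ʳ (verts t) u) h h' m m'

  Unique-roots : Unique (vertsF ts) → Unique (roots ts)
  Unique-roots {ts = []}    _ = []
  Unique-roots {ts = t ∷ _} u =
    All.tabulate (λ { m refl → Unique-++⇒disjoint (verts t) u (root∈verts t) (roots⊆vertsF m) })
    ∷ Unique-roots (Unique-++⁻ʳ (verts t) u)

  Unique-children  : Unique (verts t) → HasChildren t p cs → Unique cs
  Unique-childrenF : Unique (vertsF ts) → HasChildrenF ts p cs → Unique cs
  Unique-children {t = node _ _} (_ ∷ u) here      = Unique-roots u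
  Unique-children {t = node _ _} (_ ∷ u) (there h) = Unique-childrenF u h
  Unique-childrenF {ts = t ∷ _} u (here h)  = Unique-children (Unique-++⁻ˡ (verts t) u) h
  Unique-childrenF {ts = t ∷ _} u (there h) = Unique-childrenF (Unique-++⁻ʳ (verts t) u) h

  position-unique : ∀ {v ys ys'} xs xs' → Unique (verts t) →
                    HasChildren t p (xs ++ v ∷ ys) → HasChildren t q (xs' ++ v ∷ ys') →
                    p ≡ q × xs ≡ xs' × ys ≡ ys'
  position-unique xs xs' u h h'
    with refl ← parent-unique u h h' (∈-++⁺ʳ xs (here refl)) (∈-++⁺ʳ xs' (here refl))
    = refl , Unique-++-∷-injective xs xs' (Unique-children u h) (HasChildren-functional u h h')

  HasChildren-ext : {D D' : Tree V} → (∀ {u cs cs'} → HasChildren D u cs → HasChildren D' u cs' → cs ≡ cs') →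
                    root D ≡ root D' → D ≡ D'
  HasChildren-ext {D} {D'} agree = go D D' (λ h → h) (λ h → h)
    where
    go  : ∀ s s' → (∀ {u cs} → HasChildren s u cs → HasChildren D u cs) →
          (∀ {u cs} → HasChildren s' u cs → HasChildren D' u cs) → root s ≡ root s' → s ≡ s'
    goF : ∀ ss ss' → (∀ {u cs} → HasChildrenF ss u cs → HasChildren D u cs) →
          (∀ {u cs} → HasChildrenF ss' u cs → HasChildren D' u cs) → roots ss ≡ roots ss' → ss ≡ ss'
    go (node u ss) (node .u ss') emb emb' refl =
      cong (node u) (goF ss ss' (emb ∘ there) (emb' ∘ there) (agree (emb here) (emb' here)))
    goF []       []         _   _    _ = refl
    goF (s ∷ ss) (s' ∷ ss') emb emb' e =
      cong₂ _∷_ (go s s' (emb ∘ here) (emb' ∘ here) (∷-injectiveˡ e))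
                (goF ss ss' (emb ∘ there) (emb' ∘ there) (∷-injectiveʳ e))

  LeftOf : Tree V → V → List V → V → Set
  LeftOf D u []      x = RMC D u x
  LeftOf D u (z ∷ _) x = ILS D z x

  LeftOf⁺ : ∀ {D u} ys {x} zs → HasChildren D u (ys ++ x ∷ zs) → LeftOf D u zs x
  LeftOf⁺ ys []       h = ys , h
  LeftOf⁺ ys (z ∷ zs) h = _ , ys , zs , h

  LeftOf⁻ : ∀ {D u x} ys zs → Unique (verts D) → HasChildren D u (ys ++ zs) → LeftOf D u zs x →
            ∃[ ys₀ ] ys ≡ ys₀ ∷ʳ x
  LeftOf⁻ ys [] uD h (cs , h') = cs , trans (sym (++-identityʳ ys)) (HasChildren-functional uD h h')
  LeftOf⁻ {D} {x = x} ys (z ∷ zs) uD h (_ , cs , ds , h') =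
    cs , sym (proj₁ (proj₂ (position-unique (cs ∷ʳ x) ys uD (subst (HasChildren D _) (sym (∷ʳ-++ cs x (z ∷ ds))) h') h)))

  module _ {D D' : Tree V} (uD : Unique (verts D)) (uD' : Unique (verts D'))
           (rmc : ∀ {u v} → RMC D u v ⇔ RMC D' u v) (ils : ∀ {u v} → ILS D u v ⇔ ILS D' u v) where

    LeftOf-⇔ : ∀ {u} zs {x} → LeftOf D u zs x ⇔ LeftOf D' u zs x
    LeftOf-⇔ []      = rmc
    LeftOf-⇔ (_ ∷ _) = ils

    children-suffix-≡ : ∀ {u ys ys' zs} → Reverse ys →
                        HasChildren D u (ys ++ zs) → HasChildren D' u (ys' ++ zs) → ys ≡ ys'
    children-suffix-≡ {ys' = ys'} {zs} [] h h' with initLast ys'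
    ... | [] = refl
    ... | ys₀ ∷ʳ′ x with ys₁ , e ← LeftOf⁻ [] zs uD h (Equivalence.from (LeftOf-⇔ zs)
                                      (LeftOf⁺ ys₀ zs (subst (HasChildren D' _) (∷ʳ-++ ys₀ x zs) h')))
      = ⊥-elim (++-∷≢[] ys₁ (sym e))
    children-suffix-≡ {ys' = ys'} {zs} (ys₀ ∶ rs ∶ʳ x) h h'
      with ys₁ , refl ← LeftOf⁻ ys' zs uD' h' (Equivalence.to (LeftOf-⇔ zs)
                          (LeftOf⁺ ys₀ zs (subst (HasChildren D _) (∷ʳ-++ ys₀ x zs) h)))
      = cong (_∷ʳ x) (children-suffix-≡ rs (subst (HasChildren D _) (∷ʳ-++ ys₀ x zs) h)
                                           (subst (HasChildren D' _) (∷ʳ-++ ys₁ x zs) h'))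

    ≡-by-RMC-ILS : root D ≡ root D' → D ≡ D'
    ≡-by-RMC-ILS = HasChildren-ext λ {_} {cs} {cs'} h h' →
      children-suffix-≡ (reverseView cs) (subst (HasChildren D _) (sym (++-identityʳ cs)) h)
                                         (subst (HasChildren D' _) (sym (++-identityʳ cs')) h')

  ≡root⊎≢root : Unique (verts t) → HasChildren t p cs → p ≡ root t ⊎ p ≢ root t
  ≡root⊎≢root _        here      = inj₁ refl
  ≡root⊎≢root (w∉ ∷ _) (there h) = inj₂ λ { refl → All.lookup w∉ (parent∈vertsF h) refl }

  IsDual⇒Unique : Unique (verts T) → IsDual T D → Unique (verts D)
  IsDual⇒Unique uT dual = Unique-resp-↭ (↭-sym (IsDual.sameVerts dual)) uT

  -- Inverting the rules: a non-root vertex v of T has some position in its T-parent's child list,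
  -- each possible position makes one of (1b), (2), (3) place v in T*, and positions in T* are unique.
  module _ {T D : Tree V} (uT : Unique (verts T)) (dual : IsDual T D) where
    open IsDual dual

    private
      uD : Unique (verts D)
      uD = IsDual⇒Unique uT dual

      position-in-T : HasChildren D p cs → x ∈ cs → ∃[ q ] ∃[ xs ] ∃[ ys ] HasChildren T q (xs ++ x ∷ ys)
      position-in-T h m
        with q , _ , hT , m' ← nonroot⇒HasParent (∈-resp-↭ sameVerts (child∈verts h m))
                                                 (λ { refl → rule1a (_ , _ , h , m) })
        with xs , ys , refl ← ∈-∃++ m'
        = q , xs , ys , hT

    dual-RMC⁻ : ∀ {u v} → RMC D u v → (u ≡ root T × RMC T (root T) v) ⊎ ILS T u v
    dual-RMC⁻ {u} {v} (cs , h) with position-in-T h (∈-++⁺ʳ cs (here refl))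
    ... | p , xs , y ∷ ys , hT
      with cs' , h' ← rule3 y v (p , xs , ys , hT)
      with refl , _ ← position-unique cs cs' uD h h'
      = inj₂ (p , xs , ys , hT)
    ... | p , xs , [] , hT with ≡root⊎≢root uT hT
    ...   | inj₁ refl
      with cs' , h' ← rule1b v (xs , hT)
      with refl , _ ← position-unique cs cs' uD h h'
      = inj₁ (refl , xs , hT)
    ...   | inj₂ p≢r
      with _ , cs' , _ , h' ← rule2 p v (xs , hT) p≢r
      with _ , _ , () ← position-unique cs cs' uD h h'

    dual-ILS⁻ : ∀ {w v} → ILS D w v → RMC T w v × w ≢ root T
    dual-ILS⁻ {w} {v} (_ , cs , _ , h) with position-in-T h (∈-++⁺ʳ cs (here refl))
    ... | p , xs , y ∷ ys , hT
      with cs' , h' ← rule3 y v (p , xs , ys , hT)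
      with _ , _ , () ← position-unique cs cs' uD h h'
    ... | p , xs , [] , hT with ≡root⊎≢root uT hT
    ...   | inj₁ refl
      with cs' , h' ← rule1b v (xs , hT)
      with _ , _ , () ← position-unique cs cs' uD h h'
    ...   | inj₂ p≢r
      with _ , cs' , _ , h' ← rule2 p v (xs , hT) p≢r
      with _ , _ , refl ← position-unique cs cs' uD h h'
      = (xs , hT) , p≢r

  dual-unique : Unique (verts T) → IsDual T D → IsDual T D' → D ≡ D'
  dual-unique {T} uT d d' =
    ≡-by-RMC-ILS (IsDual⇒Unique uT d) (IsDual⇒Unique uT d')
      (mk⇔ (RMC-transfer d d') (RMC-transfer d' d)) (mk⇔ (ILS-transfer d d') (ILS-transfer d' d))
      (trans (IsDual.sameRoot d) (sym (IsDual.sameRoot d')))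
    where
    RMC-transfer : ∀ {A B : Tree V} {u v} → IsDual T A → IsDual T B → RMC A u v → RMC B u v
    RMC-transfer dA dB r with dual-RMC⁻ uT dA r
    ... | inj₁ (refl , r') = IsDual.rule1b dB _ r'
    ... | inj₂ i           = IsDual.rule3 dB _ _ i
    ILS-transfer : ∀ {A B : Tree V} {u v} → IsDual T A → IsDual T B → ILS A u v → ILS B u v
    ILS-transfer dA dB i = uncurry (IsDual.rule2 dB _ _) (dual-ILS⁻ uT dA i)

  Unique-node-++⁻ : ∀ {r} ts us → Unique (verts (node r (ts ++ us))) →
                    Unique (verts (node r ts)) × Unique (verts (node r us))
  Unique-node-++⁻ {r} ts us u = Unique-++⁻ˡ (r ∷ vertsF ts) u' , Unique-∷-++⁻ʳ (vertsF ts) u'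
    where u' = subst (Unique ∘ (r ∷_)) (vertsF-++ ts us) u

  dual-⇒-root-leaf : ∀ {r B} → Unique (verts (r ⇒ B)) → IsDual (r ⇒ B) D → ¬ RMC D (root B) x
  dual-⇒-root-leaf {x = x} {B = B} u dual rmc with dual-RMC⁻ u dual rmc
  ... | inj₁ (b≡r , _) = Unique[x∷xs]⇒x∉xs u (subst (_∈ _) b≡r (∈-++⁺ˡ (root∈verts B)))
  ... | inj₂ (_ , cs , ds , h)
    with _ , e , _ ← position-unique [] (cs ∷ʳ x) u here (subst (HasChildren _ _) (sym (∷ʳ-++ cs x (root B ∷ ds))) h)
    = ++-∷≢[] cs (sym e)

  dual-⇒-shape : ∀ {r B} → Unique (verts (r ⇒ B)) → IsDual (r ⇒ B) D → ∃[ L ] D ≡ node r (L ∷ʳ node (root B) [])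
  dual-⇒-shape {D = node _ L} {B = B} u dual
    with refl ← IsDual.sameRoot dual | cs , h ← IsDual.rule1b dual (root B) ([] , here)
    with initLast L | HasChildren-functional (IsDual⇒Unique u dual) here h
  ... | [] | e = ⊥-elim (++-∷≢[] cs (sym e))
  ... | L₀ ∷ʳ′ node b Y | e with _ , refl ← ∷ʳ-injective (roots L₀) cs (trans (sym (roots-++ L₀ _)) e)
    with initLast Y
  ...   | [] = L₀ , refl
  ...   | Y₀ ∷ʳ′ y = ⊥-elim (dual-⇒-root-leaf u dual
                        (roots Y₀ , subst (HasChildren _ _) (roots-++ Y₀ [ y ]) (there (++⁺ʳ L₀ (here here)))))

  children-∷ʳ⁻ : ∀ {r As B} → HasChildren (node r (As ∷ʳ B)) p cs →
                 (p ≡ r × cs ≡ roots As ∷ʳ root B) ⊎ HasChildren (node r As) p cs ⊎ HasChildren (r ⇒ B) p cs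
  children-∷ʳ⁻ {As = As} {B} here = inj₁ (refl , roots-++ As [ B ])
  children-∷ʳ⁻ {As = As} (there h) with ++⁻ As h
  ... | inj₁ h'        = inj₂ (inj₁ (there h'))
  ... | inj₂ (here h') = inj₂ (inj₂ (there (here h')))

  module Join (r b : V) (M L : List (Tree V)) where

    J E K : Tree V
    J = node r M
    E = node r (L ∷ʳ node b [])
    K = node r (L ∷ʳ node b M)

    J↷E≡K : J ↷ E ≡ K
    J↷E≡K = cong (node r) (graft-leaf M L b)

    b-children : HasChildren K b (roots M)
    b-children = there (++⁺ʳ L (here here))

    children-J⁺ : HasChildren J p cs → (p ≡ r × HasChildren K b cs) ⊎ HasChildren K p cs
    children-J⁺ here      = inj₁ (refl , b-children)
    children-J⁺ (there h) = inj₂ (there (++⁺ʳ L (here (there h))))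

    children-E⁺ : HasChildren E p cs → cs ≡ [] ⊎ HasChildren K p cs
    children-E⁺ here = inj₂ (subst (HasChildren K r) (trans (roots-++ L _) (sym (roots-++ L _))) here)
    children-E⁺ (there h) with ++⁻ L h
    ... | inj₁ h'          = inj₂ (there (++⁺ˡ h'))
    ... | inj₂ (here here) = inj₁ refl

    ILS-J⁺ : ILS J u v → ILS K u v
    ILS-J⁺ (p , cs , ds , h) with children-J⁺ h
    ... | inj₁ (_ , h') = b , cs , ds , h'
    ... | inj₂ h'       = p , cs , ds , h'

    ILS-E⁺ : ILS E u v → ILS K u v
    ILS-E⁺ (p , cs , ds , h) with children-E⁺ h
    ... | inj₁ e  = ⊥-elim (++-∷≢[] cs e)
    ... | inj₂ h' = p , cs , ds , h'

    RMC-E⁺ : RMC E u v → RMC K u v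
    RMC-E⁺ (cs , h) with children-E⁺ h
    ... | inj₁ e  = ⊥-elim (++-∷≢[] cs e)
    ... | inj₂ h' = cs , h'

    RMC-J⁺ : RMC J u v → u ≢ r → RMC K u v
    RMC-J⁺ (cs , h) u≢r with children-J⁺ h
    ... | inj₁ (refl , _) = ⊥-elim (u≢r refl)
    ... | inj₂ h'         = cs , h'

    RMC-J-root⁺ : Unique (verts J) → RMC J r v → RMC K b v
    RMC-J-root⁺ uJ (cs , h) = cs , subst (HasChildren K b) (HasChildren-functional uJ here h) b-children

  private
    module JoinDual {r : V} {As : List (Tree V)} {B : Tree V} {M L : List (Tree V)}
                    (uT₁ : Unique (verts (node r (As ∷ʳ B))))
                    (dJ : IsDual (node r As) (node r M))
                    (dE : IsDual (r ⇒ B) (node r (L ∷ʳ node (root B) [])))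
                    where

      open Join r (root B) M L

      T₀ T₁ : Tree V
      T₀ = node r As
      T₁ = node r (As ∷ʳ B)

      uJ : Unique (verts J)
      uJ = IsDual⇒Unique (proj₁ (Unique-node-++⁻ As [ B ] uT₁)) dJ

      verts-K : verts K ↭ verts T₁
      verts-K = prep r (begin
        vertsF (L ∷ʳ node (root B) M)                   ≡⟨ vertsF-++ L _ ⟩
        vertsF L ++ root B ∷ vertsF M ++ []             ≡⟨ cong (λ xs → vertsF L ++ root B ∷ xs) (++-identityʳ _) ⟩
        vertsF L ++ root B ∷ vertsF M                   ≡⟨ ∷ʳ-++ (vertsF L) (root B) (vertsF M) ⟨
        (vertsF L ∷ʳ root B) ++ vertsF M                ↭⟨ ↭.++⁺ verts-L (drop-∷ (IsDual.sameVerts dJ)) ⟩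
        vertsF [ B ] ++ vertsF As                       ↭⟨ ++-comm (vertsF [ B ]) (vertsF As) ⟩
        vertsF As ++ vertsF [ B ]                       ≡⟨ vertsF-++ As [ B ] ⟨
        vertsF (As ∷ʳ B)                                ∎)
        where
        open PermutationReasoning
        verts-L : vertsF L ∷ʳ root B ↭ vertsF [ B ]
        verts-L = ↭.trans (↭.↭-reflexive (sym (vertsF-++ L _))) (drop-∷ (IsDual.sameVerts dE))

      rule1b : ∀ v → RMC T₁ r v → RMC K r v
      rule1b v (cs , h)
        with refl ← ∷ʳ-injectiveʳ (roots As) cs (trans (sym (roots-++ As [ B ])) (HasChildren-functional uT₁ here h))
        = roots L , subst (HasChildren K r) (roots-++ L _) here

      rule2 : ∀ u v → RMC T₁ u v → u ≢ r → ILS K u v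
      rule2 u v (cs , h) u≢r with children-∷ʳ⁻ h
      ... | inj₁ (refl , _) = ⊥-elim (u≢r refl)
      ... | inj₂ (inj₁ hT)  = ILS-J⁺ (IsDual.rule2 dJ u v (cs , hT) u≢r)
      ... | inj₂ (inj₂ hS)  = ILS-E⁺ (IsDual.rule2 dE u v (cs , hS) u≢r)

      rule3-last : ∀ cs → cs ++ v ∷ u ∷ [] ≡ roots As ∷ʳ root B → RMC K u v
      rule3-last {v} cs e with roots≡ , refl ← ∷ʳ-injective (cs ∷ʳ v) (roots As) (trans (∷ʳ-++ cs v _) e)
        = RMC-J-root⁺ uJ (IsDual.rule1b dJ v (cs , subst (HasChildren T₀ r) (sym roots≡) here))

      rule3-inner : ∀ cs ds d → cs ++ v ∷ u ∷ ds ∷ʳ d ≡ roots As ∷ʳ root B → u ≢ r → RMC K u v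
      rule3-inner {v} {u} cs ds d e u≢r with roots≡ , _ ← ∷ʳ-injective _ (roots As) (trans (++-assoc cs (v ∷ u ∷ ds) _) e)
        = RMC-J⁺ (IsDual.rule3 dJ u v (r , cs , ds , subst (HasChildren T₀ r) (sym roots≡) here)) u≢r

      rule3-root : ∀ cs ds → cs ++ v ∷ u ∷ ds ≡ roots As ∷ʳ root B → u ≢ r → RMC K u v
      rule3-root cs ds e u≢r with initLast ds
      ... | []        = rule3-last cs e
      ... | ds₀ ∷ʳ′ d = rule3-inner cs ds₀ d e u≢r

      rule3 : ∀ u v → ILS T₁ u v → RMC K u v
      rule3 u v (p , cs , ds , h) with children-∷ʳ⁻ h | child≢root uT₁ h (∈-++⁺ʳ cs (there (here refl)))
      ... | inj₁ (refl , e) | u≢r = rule3-root cs ds e u≢r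
      ... | inj₂ (inj₁ hT)  | u≢r = RMC-J⁺ (IsDual.rule3 dJ u v (p , cs , ds , hT)) u≢r
      ... | inj₂ (inj₂ hS)  | _   = RMC-E⁺ (IsDual.rule3 dE u v (p , cs , ds , hS))

      isDual : IsDual T₁ K
      isDual = record
        { sameRoot  = refl
        ; sameVerts = verts-K
        ; rule1a    = root-orphan (Unique-resp-↭ (↭-sym verts-K) uT₁)
        ; rule1b    = rule1b
        ; rule2     = rule2
        ; rule3     = rule3
        }

  ↷-dual : ∀ {r As B J} → Unique (verts (node r (As ∷ʳ B))) → IsDual (node r As) J → IsDual (r ⇒ B) D →
           IsDual (node r (As ∷ʳ B)) (J ↷ D)
  ↷-dual {r = r} {As} {B} {node _ M} u dJ dD
    with refl ← IsDual.sameRoot dJ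
    with L , refl ← dual-⇒-shape (proj₂ (Unique-node-++⁻ As [ B ] u)) dD
    = subst (IsDual _) (sym (Join.J↷E≡K r (root B) M L)) (JoinDual.isDual u dJ dD)

  joinAll-dual : ∀ {r As} Bs {Ds} → Unique (verts (node r (As ++ Bs))) → IsDual (node r As) D →
                 Pointwise (λ A D → IsDual (r ⇒ A) D) Bs Ds → IsDual (node r (As ++ Bs)) (joinAll D Ds)
  joinAll-dual {r = r} {As} [] u d [] = subst (λ ts → IsDual (node r ts) _) (sym (++-identityʳ As)) d
  joinAll-dual {r = r} {As} (B ∷ Bs) u d (dB ∷ ds) =
    subst (λ ts → IsDual (node r ts) _) (∷ʳ-++ As B Bs)
      (joinAll-dual Bs u' (↷-dual (proj₁ (Unique-node-++⁻ (As ∷ʳ B) Bs u')) d dB) ds)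
    where u' = subst (λ ts → Unique (verts (node r ts))) (sym (∷ʳ-++ As B Bs)) u

lemma6 : {V : Set} (r : V) (A₁ : Tree V) (As : List (Tree V)) →
           Unique (verts (node r (A₁ ∷ As))) →
           (D₁ : Tree V) (Ds : List (Tree V)) →
           Pointwise (λ A D → IsDual (r ⇒ A) D) (A₁ ∷ As) (D₁ ∷ Ds) →
           (D : Tree V) → (IsDual (node r (A₁ ∷ As)) D ⇔ D ≡ joinAll D₁ Ds)
lemma6 r A₁ As u D₁ Ds (d₁ ∷ ds) D = mk⇔ (λ d → dual-unique u d dual) (λ { refl → dual })
  where
  dual : IsDual (node r (A₁ ∷ As)) (joinAll D₁ Ds)
  dual = joinAll-dual {As = [ A₁ ]} As u d₁ ds
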